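{- Let $1\le\kappa\le\omega$. Then the first-order theory $\mathrm{Th}(\mathcal{F}_\kappa)$ of the term algebra of rank $\kappa$ is not model complete.
   Context: $\Sigma=\{f_0,\dots,f_k\}$ is a finite purely functional signature, $f_i$ of arity $n_i$, with at least one $f_i$ of arity $\ge2$. $\mathcal{F}_\kappa$ is the absolutely free $\Sigma$-algebra on $\kappa$ generators (ground terms over $\kappa$ constants, interpreted syntactically, regarded as a $\Sigma$-structure without constants). A theory $T$ is model complete if whenever $\mathcal{A},\mathcal{B}\models T$ and $\mathcal{A}\subseteq\mathcal{B}$, $\mathcal{A}$ is an elementary substructure of $\mathcal{B}$. -}

module Defs where

open import Data.Nat using (ℕ; zero; suc; _≤_)
open import Data.Fin using (Fin; zero; suc)
open import Data.Vec using (Vec; []; _∷_)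
open import Data.Product using (Σ; _×_; _,_)
open import Data.Empty using (⊥)
open import Data.Unit using (⊤)
open import Relation.Nullary using (¬_)
open import Relation.Binary.PropositionalEquality using (_≡_)
open import Function.Definitions using (Injective)

record Signature : Set where
  field
    nsym  : ℕ
    arity : Fin nsym → ℕ

open Signature public

HasSymbolOfArity≥2 : Signature → Set
HasSymbolOfArity≥2 S = Σ (Fin (nsym S)) λ i → 2 ≤ arity S i

record Structure (S : Signature) : Set₁ where
  field
    Carrier : Set
    op      : (i : Fin (nsym S)) → Vec Carrier (arity S i) → Carrier

open Structure public

module _ (S : Signature) where

  data Term (n : ℕ) : Set where
    var : Fin n → Term n
    app : (i : Fin (nsym S)) → Vec (Term n) (arity S i) → Term n

  data Formula : ℕ → Set where
    _≐_  : ∀ {n} → Term n → Term n → Formula n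
    ff   : ∀ {n} → Formula n
    ~_   : ∀ {n} → Formula n → Formula n
    _∧'_ : ∀ {n} → Formula n → Formula n → Formula n
    _∨'_ : ∀ {n} → Formula n → Formula n → Formula n
    _⇒'_ : ∀ {n} → Formula n → Formula n → Formula n
    all' : ∀ {n} → Formula (suc n) → Formula n
    ex'  : ∀ {n} → Formula (suc n) → Formula n

  Sentence : Set
  Sentence = Formula 0

extend : ∀ {A : Set} {n} → A → (Fin n → A) → Fin (suc n) → A
extend a ρ zero    = a
extend a ρ (suc k) = ρ k

module _ {S : Signature} (M : Structure S) where

  mutual
    eval : ∀ {n} → Term S n → (Fin n → Carrier M) → Carrier M
    eval (var x)    ρ = ρ x
    eval (app i ts) ρ = op M i (evals ts ρ)

    evals : ∀ {n m} → Vec (Term S n) m → (Fin n → Carrier M) → Vec (Carrier M) m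
    evals []       ρ = []
    evals (t ∷ ts) ρ = eval t ρ ∷ evals ts ρ

  -- Classical (Tarskian) satisfaction, rendered constructively via the
  -- Gödel–Gentzen negative translation (atoms, ∨ and ∃ double-negated).
  Sat : ∀ {n} → Formula S n → (Fin n → Carrier M) → Set
  Sat (t ≐ u)   ρ = ¬ ¬ (eval t ρ ≡ eval u ρ)
  Sat ff        ρ = ⊥
  Sat (~ φ)     ρ = ¬ Sat φ ρ
  Sat (φ ∧' ψ)  ρ = Sat φ ρ × Sat ψ ρ
  Sat (φ ∨' ψ)  ρ = ¬ (¬ Sat φ ρ × ¬ Sat ψ ρ)
  Sat (φ ⇒' ψ)  ρ = Sat φ ρ → Sat ψ ρ
  Sat (all' φ)  ρ = (a : Carrier M) → Sat φ (extend a ρ)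
  Sat (ex' φ)   ρ = ¬ ((a : Carrier M) → ¬ Sat φ (extend a ρ))

  _⊨_ : Sentence S → Set
  _⊨_ φ = Sat φ (λ ())

Theory : Signature → Set₁
Theory S = Sentence S → Set

Th : ∀ {S} → Structure S → Theory S
Th M φ = M ⊨ φ

_Models_ : ∀ {S} → Structure S → Theory S → Set
A Models T = ∀ φ → T φ → A ⊨ φ

-- A ⊆ B: an embedding (injective homomorphism), i.e. A is, up to
-- this identification, a substructure of B
record Embedding {S} (A B : Structure S) : Set where
  field
    map  : Carrier A → Carrier B
    inj  : Injective _≡_ _≡_ map
    hom  : ∀ i (as : Vec (Carrier A) (arity S i)) →
           map (op A i as) ≡ op B i (Data.Vec.map map as)

open Embedding public

Elementary : ∀ {S} {A B : Structure S} → Embedding A B → Set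
Elementary {S} {A} {B} h =
  ∀ n (φ : Formula S n) (ρ : Fin n → Carrier A) →
    (Sat A φ ρ → Sat B φ (λ x → map h (ρ x))) ×
    (Sat B φ (λ x → map h (ρ x)) → Sat A φ ρ)

ModelComplete : ∀ {S} → Theory S → Set₁
ModelComplete {S} T =
  (A B : Structure S) → A Models T → B Models T →
  (h : Embedding A B) → Elementary h

data Rank : Set where
  finite : ℕ → Rank
  omega  : Rank

Gen : Rank → Set
Gen (finite n) = Fin n
Gen omega      = ℕ

1≤ : Rank → Set
1≤ (finite n) = 1 ≤ n
1≤ omega      = ⊤

data GroundTerm (S : Signature) (G : Set) : Set where
  gen : G → GroundTerm S G
  app : (i : Fin (nsym S)) → Vec (GroundTerm S G) (arity S i) → GroundTerm S G

TermAlgebra : (S : Signature) → Rank → Structure S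
TermAlgebra S κ = record { Carrier = GroundTerm S (Gen κ) ; op = app }

{-# OPTIONS --safe #-}

-- Fix a symbol f of positive arity and a generator g. The endomorphism of
-- the term algebra that replaces every generator x by f(x, …, x) is an
-- embedding of the term algebra into itself, since the original term can be
-- read back off the image. But "∃ y. x = f(y, …, y)" fails for x = g and
-- holds for its image f(g, …, g), so this embedding is not elementary, whereas
-- model completeness of Th(F_κ) would make every self-embedding of F_κ
-- elementary.
module Submission where

open import Defs
open import Relation.Nullary using (¬_)
open import Data.Nat using (suc; _≤_)
open import Data.Nat.Properties using (<⇒≤)
open import Data.Fin using (Fin; zero; suc)
open import Data.Vec using (Vec; []; _∷_; replicate)
import Data.Vec as Vec
open import Data.Product using (_,_; proj₂)
open import Relation.Binary.PropositionalEquality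
  using (_≡_; refl; cong; cong₂; sym; module ≡-Reasoning)

GroundTermAlgebra : (S : Signature) → Set → Structure S
GroundTermAlgebra S G = record { Carrier = GroundTerm S G ; op = app }

Th-modelComplete⇒selfEmbedding-elementary : ∀ {S} (M : Structure S) →
  ModelComplete (Th M) → (h : Embedding M M) → Elementary h
Th-modelComplete⇒selfEmbedding-elementary M mc = mc M M (λ _ M⊨φ → M⊨φ) (λ _ M⊨φ → M⊨φ)

diagonalImage : ∀ {S} → Fin (nsym S) → Formula S 1
diagonalImage {S} f = ex' (var (suc zero) ≐ app f (replicate (arity S f) (var zero)))

evals-replicate : ∀ {S} (M : Structure S) {n} (t : Term S n) (ρ : Fin n → Carrier M) k →
  evals M (replicate k t) ρ ≡ replicate k (eval M t ρ)
evals-replicate M t ρ 0       = refl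
evals-replicate M t ρ (suc k) = cong (eval M t ρ ∷_) (evals-replicate M t ρ k)

module WrapGenerators (S : Signature) (G : Set) (f : Fin (nsym S)) (1≤arity : 1 ≤ arity S f) where

  F : Structure S
  F = GroundTermAlgebra S G

  mutual
    wrap : GroundTerm S G → GroundTerm S G
    wrap (gen x)    = app f (replicate (arity S f) (gen x))
    wrap (app i ts) = app i (wraps ts)

    wraps : ∀ {n} → Vec (GroundTerm S G) n → Vec (GroundTerm S G) n
    wraps []       = []
    wraps (t ∷ ts) = wrap t ∷ wraps ts

  wraps≡map-wrap : ∀ {n} (ts : Vec (GroundTerm S G) n) → wraps ts ≡ Vec.map wrap ts
  wraps≡map-wrap []       = refl
  wraps≡map-wrap (t ∷ ts) = cong (wrap t ∷_) (wraps≡map-wrap ts)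

  -- wrap never returns a generator, so an application whose first argument
  -- is a generator x can only be wrap (gen x).
  mutual
    unwrap : GroundTerm S G → GroundTerm S G
    unwrap (gen x)    = gen x
    unwrap (app i ts) = unwrapApp (app i) ts

    unwrapApp : ∀ {n} → (Vec (GroundTerm S G) n → GroundTerm S G) →
                Vec (GroundTerm S G) n → GroundTerm S G
    unwrapApp c []              = c []
    unwrapApp c (gen x ∷ ts)    = gen x
    unwrapApp c (app i us ∷ ts) = c (unwraps (app i us ∷ ts))

    unwraps : ∀ {n} → Vec (GroundTerm S G) n → Vec (GroundTerm S G) n
    unwraps []       = []
    unwraps (t ∷ ts) = unwrap t ∷ unwraps ts

  unwrapApp-replicate-gen : ∀ {n} (c : Vec (GroundTerm S G) n → GroundTerm S G) x →
    1 ≤ n → unwrapApp c (replicate n (gen x)) ≡ gen x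
  unwrapApp-replicate-gen {suc n} c x _ = refl

  mutual
    unwrap∘wrap : ∀ t → unwrap (wrap t) ≡ t
    unwrap∘wrap (gen x)    = unwrapApp-replicate-gen (app f) x 1≤arity
    unwrap∘wrap (app i ts) = unwrapApp-wraps (app i) ts

    unwrapApp-wraps : ∀ {n} (c : Vec (GroundTerm S G) n → GroundTerm S G) ts →
      unwrapApp c (wraps ts) ≡ c ts
    unwrapApp-wraps c []                = refl
    unwrapApp-wraps c ts@(gen _ ∷ _)    = cong c (unwraps∘wraps ts)
    unwrapApp-wraps c ts@(app _ _ ∷ _)  = cong c (unwraps∘wraps ts)

    unwraps∘wraps : ∀ {n} (ts : Vec (GroundTerm S G) n) → unwraps (wraps ts) ≡ ts
    unwraps∘wraps []       = refl
    unwraps∘wraps (t ∷ ts) = cong₂ _∷_ (unwrap∘wrap t) (unwraps∘wraps ts)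

  wrapEmbedding : Embedding F F
  wrapEmbedding = record
    { map = wrap
    ; inj = λ {s} {t} wrap-s≡wrap-t → begin
        s                ≡⟨ sym (unwrap∘wrap s) ⟩
        unwrap (wrap s)  ≡⟨ cong unwrap wrap-s≡wrap-t ⟩
        unwrap (wrap t)  ≡⟨ unwrap∘wrap t ⟩
        t                ∎
    ; hom = λ i ts → cong (app i) (wraps≡map-wrap ts)
    }
    where open ≡-Reasoning

  gen∉diagonalImage : ∀ x → ¬ Sat F (diagonalImage f) (λ _ → gen x)
  gen∉diagonalImage x ∃y = ∃y (λ y ¬¬gen≡app → ¬¬gen≡app (λ ()))

  wrap-gen∈diagonalImage : ∀ x → Sat F (diagonalImage f) (λ _ → wrap (gen x))
  wrap-gen∈diagonalImage x ∄y =
    ∄y (gen x) (λ wrap-gen≢ → wrap-gen≢ (cong (app f) (sym (evals-replicate F (var zero) _ (arity S f)))))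

  wrapEmbedding-notElementary : G → ¬ Elementary wrapEmbedding
  wrapEmbedding-notElementary x elementary =
    gen∉diagonalImage x (proj₂ (elementary 1 (diagonalImage f) (λ _ → gen x)) (wrap-gen∈diagonalImage x))

someGenerator : (κ : Rank) → 1≤ κ → Gen κ
someGenerator (finite (suc n)) _ = zero
someGenerator omega            _ = 0

mainTheorem7 : (S : Signature) → HasSymbolOfArity≥2 S →
    (κ : Rank) → 1≤ κ →
    ¬ ModelComplete (Th (TermAlgebra S κ))
mainTheorem7 S (f , 2≤arity) κ 1≤κ mc =
  wrapEmbedding-notElementary (someGenerator κ 1≤κ)
    (Th-modelComplete⇒selfEmbedding-elementary F mc wrapEmbedding)
  where open WrapGenerators S (Gen κ) f (<⇒≤ 2≤arity)
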